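{- Let $T$ be a pre-Galois word and $p_o=\mathrm{Per}_o(T)$. Let $z$ be a symbol and $T'=T\cdot z$ with $T'[1..|T|-p_o+1]\prec_{\mathrm{alt}}T'[p_o+1..|T|+1]$. Then $\mathrm{Per}_o(T')=|T'|$ if $|T'|$ is odd, and $\mathrm{Per}_o(T')=|T'|+1$ otherwise.
   Context: $W[i..j]$ is the factor from position $i$ to $j$ (1-indexed), and is $\varepsilon$ if $i>j$. An integer $p\in[1..|W|]$ is a period of $W$ if $W[i+p]=W[i]$ for all $i\in[1..|W|-p]$. $\mathrm{Per}_o(W)$ is the shortest odd period of $W$, set to $|W|+1$ if none exists. Alternating order: for words $S,T$ with $S^\omega\neq T^\omega$ ($X^\omega$ the infinite repetition of $X$), let $j$ be the first position with $S^\omega[j]\neq T^\omega[j]$; $S\prec_{\mathrm{alt}}T$ if $j$ is odd and $S^\omega[j]<T^\omega[j]$, or $j$ is even and $S^\omega[j]>T^\omega[j]$. $S=_{\mathrm{alt}}T$ if $S^\omega=T^\omega$; $\varepsilon\succ_{\mathrm{alt}}X$ for every nonempty $X$. A word $T$ is pre-Galois if every proper suffix $S$ of $T$ is a prefix of $T$ or satisfies $S\succ_{\mathrm{alt}}T$. -}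

module Defs where

open import Level using (Level)
open import Data.Nat using (ℕ; zero; suc; _+_; _∸_; _≤_; _<_; _%_)
open import Data.Nat.DivMod using (m%n<n)
open import Data.List using (List; []; _∷_; length; take; drop; _++_; lookup)
open import Data.List.Base using ([_])
open import Data.Maybe using (Maybe; just; nothing)
open import Data.Fin using (fromℕ<)
open import Data.Product using (_×_; Σ; ∃)
open import Data.Sum using (_⊎_)
open import Data.Empty using (⊥)
open import Data.Unit using (⊤)
open import Relation.Nullary using (¬_)
open import Relation.Binary.Core using (Rel)
open import Relation.Binary.PropositionalEquality using (_≡_)

private variable
  a ℓ : Level

Odd : ℕ → Set
Odd n = n % 2 ≡ 1

Even : ℕ → Set
Even n = n % 2 ≡ 0

-- Words over an alphabet A are lists.  0-indexed access (nothing if out of range).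
at : {A : Set a} → List A → ℕ → Maybe A
at []       _       = nothing
at (x ∷ xs) zero    = just x
at (x ∷ xs) (suc i) = at xs i

-- W[i..j], 1-indexed, ε if i > j.
factor : {A : Set a} → List A → ℕ → ℕ → List A
factor W i j = take (suc j ∸ i) (drop (i ∸ 1) W)

-- p is a period of W: p ∈ [1..|W|] and W[i+p] = W[i] for i ∈ [1..|W|-p]
-- (stated 0-indexed: for all i with i + p < |W|).
IsPeriod : {A : Set a} → List A → ℕ → Set a
IsPeriod W p = (1 ≤ p) × (p ≤ length W) × (∀ i → i + p < length W → at W (i + p) ≡ at W i)

PerO : {A : Set a} → List A → ℕ → Set a
PerO W q =
    (IsPeriod W q × Odd q × (∀ p → IsPeriod W p → Odd p → q ≤ p))
  ⊎ ((q ≡ suc (length W)) × (∀ p → IsPeriod W p → ¬ Odd p))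

-- X^ω for nonempty X = x ∷ xs, as a 0-indexed infinite word.
omega : {A : Set a} → A → List A → ℕ → A
omega x xs i = lookup (x ∷ xs) (fromℕ< (m%n<n i (length (x ∷ xs))))

-- Alternating order S ≺alt T w.r.t. a strict order _<ₐ_ on the alphabet.
-- The first difference is at 1-indexed position j = i + 1; j odd iff i even.
infix 4 _⊢_≺alt_
_⊢_≺alt_ : {A : Set a} → Rel A ℓ → List A → List A → Set (Level._⊔_ a ℓ)
_<ₐ_ ⊢ [] ≺alt _      = Level.Lift _ ⊥            -- ε is the largest word
_<ₐ_ ⊢ (x ∷ xs) ≺alt []     = Level.Lift _ ⊤
_<ₐ_ ⊢ (x ∷ xs) ≺alt (y ∷ ys) =
  Σ ℕ λ i → (∀ k → k < i → omega x xs k ≡ omega y ys k)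
          × ((Even i × (omega x xs i <ₐ omega y ys i))
            ⊎ (Odd i × (omega y ys i <ₐ omega x xs i)))

IsPrefix : {A : Set a} → List A → List A → Set a
IsPrefix S T = ∃ λ U → T ≡ S ++ U

PreGalois : {A : Set a} → Rel A ℓ → List A → Set (Level._⊔_ a ℓ)
PreGalois _<ₐ_ T = ∀ k → 1 ≤ k → k ≤ length T →
  IsPrefix (drop k T) T ⊎ (_<ₐ_ ⊢ T ≺alt drop k T)

{-# OPTIONS --safe #-}
module Submission where

-- Positions are counted from 0 and n = |T|.  Suppose T·z had an odd period p ≤ n.  Then p is
-- an odd period of T, so pₒ ≤ p, and T[n−p] = z.  The two words compared in the hypothesis
-- agree up to their last position r = n − pₒ, where they carry c = T[r] and z; so c ≠ z and
-- c, z are in alternating order at r.  If p = pₒ this contradicts T[n−p] = z.  Otherwise the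
-- suffix of T starting at p − pₒ agrees with T up to position n − p, where it carries c against
-- T's z, and pre-Galois-ness puts z, c in alternating order there.  Since p − pₒ is even, both
-- positions have the same parity and the two comparisons contradict each other.  Hence the
-- only odd period T·z can have is |T·z|.

open import Defs
open import Level using (Level; lift)
open import Data.Nat using (ℕ; zero; suc; _∸_; _+_; _*_; _/_; _≤_; _<_; _%_; z≤n; s≤s)
open import Data.Nat.Properties
open import Data.Nat.DivMod using (m%n<n; m<n⇒m%n≡m; m≡m%n+[m/n]*n; [m+kn]%n≡m%n; m*n%n≡0)
open import Data.List using (List; []; _∷_; length; _++_; [_]; take; drop; lookup)
open import Data.List.Properties using (length-++)
open import Data.Maybe.Base using (just; nothing)
open import Data.Maybe.Properties using (just-injective)
open import Data.Fin using (fromℕ<)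
open import Data.Product using (_×_; _,_; proj₁; proj₂; ∃)
open import Data.Sum using (_⊎_; inj₁; inj₂)
open import Data.Empty using (⊥; ⊥-elim)
open import Function using (_∘_)
open import Relation.Nullary using (¬_)
open import Relation.Binary.Core using (Rel)
open import Relation.Binary.Definitions using (tri<; tri≈; tri>)
open import Relation.Binary.Structures using (IsStrictTotalOrder)
open import Relation.Binary.PropositionalEquality
  using (_≡_; _≢_; refl; sym; trans; cong; cong₂; subst; subst₂; module ≡-Reasoning)

private variable
  a ℓ : Level
  A : Set a

odd⇒¬even : ∀ n → Odd n → ¬ Even n
odd⇒¬even _ odd even with trans (sym odd) even
... | ()

[m%2≡n%2]⇒even[m∸n] : ∀ m n → m % 2 ≡ n % 2 → Even (m ∸ n)
[m%2≡n%2]⇒even[m∸n] m n m≡n = trans (cong (_% 2) m∸n≡[m/2∸n/2]*2) (m*n%n≡0 (m / 2 ∸ n / 2) 2)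
  where
  open ≡-Reasoning
  m∸n≡[m/2∸n/2]*2 : m ∸ n ≡ (m / 2 ∸ n / 2) * 2
  m∸n≡[m/2∸n/2]*2 = begin
    m ∸ n                                        ≡⟨ cong₂ _∸_ (m≡m%n+[m/n]*n m 2) (m≡m%n+[m/n]*n n 2) ⟩
    (m % 2 + m / 2 * 2) ∸ (n % 2 + n / 2 * 2)  ≡⟨ cong (λ t → (t + m / 2 * 2) ∸ (n % 2 + n / 2 * 2)) m≡n ⟩
    (n % 2 + m / 2 * 2) ∸ (n % 2 + n / 2 * 2)  ≡⟨ [m+n]∸[m+o]≡n∸o (n % 2) (m / 2 * 2) (n / 2 * 2) ⟩
    m / 2 * 2 ∸ n / 2 * 2                        ≡⟨ *-distribʳ-∸ 2 (m / 2) (n / 2) ⟨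
    (m / 2 ∸ n / 2) * 2                          ∎

even⇒[m+n]%2≡n%2 : ∀ m n → Even m → (m + n) % 2 ≡ n % 2
even⇒[m+n]%2≡n%2 m n even = begin
  (m + n) % 2                    ≡⟨ cong (_% 2) (+-comm m n) ⟩
  (n + m) % 2                    ≡⟨ cong (λ t → (n + t) % 2) (m≡m%n+[m/n]*n m 2) ⟩
  (n + (m % 2 + m / 2 * 2)) % 2  ≡⟨ cong (λ t → (n + (t + m / 2 * 2)) % 2) even ⟩
  (n + m / 2 * 2) % 2            ≡⟨ [m+kn]%n≡m%n n (m / 2) 2 ⟩
  n % 2                          ∎
  where open ≡-Reasoning

[p∸q]+[n∸p]≡n∸q : ∀ {n p q} → q ≤ p → p ≤ n → (p ∸ q) + (n ∸ p) ≡ n ∸ q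
[p∸q]+[n∸p]≡n∸q {n} {p} {q} q≤p p≤n = begin
  (p ∸ q) + (n ∸ p)  ≡⟨ +-comm (p ∸ q) (n ∸ p) ⟩
  (n ∸ p) + (p ∸ q)  ≡⟨ +-∸-assoc (n ∸ p) q≤p ⟨
  (n ∸ p + p) ∸ q    ≡⟨ cong (_∸ q) (m∸n+n≡m p≤n) ⟩
  n ∸ q              ∎
  where open ≡-Reasoning

module _ {A : Set a} where

  length-snoc : ∀ (xs : List A) z → length (xs ++ [ z ]) ≡ suc (length xs)
  length-snoc xs z = trans (length-++ xs) (+-comm (length xs) 1)

  at-just⇒< : ∀ (xs : List A) i {c} → at xs i ≡ just c → i < length xs
  at-just⇒< (x ∷ xs) zero    _   = s≤s z≤n
  at-just⇒< (x ∷ xs) (suc i) eq  = s≤s (at-just⇒< xs i eq)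

  <⇒at-just : ∀ (xs : List A) i → i < length xs → ∃ λ c → at xs i ≡ just c
  <⇒at-just (x ∷ xs) zero    _         = x , refl
  <⇒at-just (x ∷ xs) (suc i) (s≤s i<n) = <⇒at-just xs i i<n

  at-lookup : ∀ (xs : List A) i (i<n : i < length xs) → at xs i ≡ just (lookup xs (fromℕ< i<n))
  at-lookup (x ∷ xs) zero    _         = refl
  at-lookup (x ∷ xs) (suc i) (s≤s i<n) = at-lookup xs i i<n

  at-++ˡ : ∀ (xs ys : List A) i → i < length xs → at (xs ++ ys) i ≡ at xs i
  at-++ˡ (x ∷ xs) ys zero    _         = refl
  at-++ˡ (x ∷ xs) ys (suc i) (s≤s i<n) = at-++ˡ xs ys i i<n

  at-++-length : ∀ (xs : List A) z → at (xs ++ [ z ]) (length xs) ≡ just z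
  at-++-length []       z = refl
  at-++-length (x ∷ xs) z = at-++-length xs z

  at-drop : ∀ (xs : List A) k i → at (drop k xs) i ≡ at xs (k + i)
  at-drop xs       zero    i = refl
  at-drop []       (suc k) i = refl
  at-drop (x ∷ xs) (suc k) i = at-drop xs k i

  at-take< : ∀ (xs : List A) k i → i < k → at (take k xs) i ≡ at xs i
  at-take< []       (suc k) i       _         = refl
  at-take< (x ∷ xs) (suc k) zero    _         = refl
  at-take< (x ∷ xs) (suc k) (suc i) (s≤s i<k) = at-take< xs k i i<k

  at-take≥ : ∀ (xs : List A) k i → k ≤ i → at (take k xs) i ≡ nothing
  at-take≥ xs       zero    i       _         = refl
  at-take≥ []       (suc k) i       _         = refl
  at-take≥ (x ∷ xs) (suc k) (suc i) (s≤s k≤i) = at-take≥ xs k i k≤i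

  at-extensionality : ∀ (xs ys : List A) → (∀ i → at xs i ≡ at ys i) → xs ≡ ys
  at-extensionality []       []       _  = refl
  at-extensionality []       (y ∷ ys) eq with eq 0
  ... | ()
  at-extensionality (x ∷ xs) []       eq with eq 0
  ... | ()
  at-extensionality (x ∷ xs) (y ∷ ys) eq =
    cong₂ _∷_ (just-injective (eq 0)) (at-extensionality xs ys (λ i → eq (suc i)))

  at-isPrefix : ∀ {S T : List A} {i c} → IsPrefix S T → at S i ≡ just c → at T i ≡ just c
  at-isPrefix {S} {i = i} (U , refl) atS = trans (at-++ˡ S U i (at-just⇒< S i atS)) atS

  at≡just⇒omega≡ : ∀ x (xs : List A) i {c} → at (x ∷ xs) i ≡ just c → omega x xs i ≡ c
  at≡just⇒omega≡ x xs i atᵢ = just-injective (begin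
    just (omega x xs i)        ≡⟨ at-lookup (x ∷ xs) (i % L) (m%n<n i L) ⟨
    at (x ∷ xs) (i % L)        ≡⟨ cong (at (x ∷ xs)) (m<n⇒m%n≡m (at-just⇒< (x ∷ xs) i atᵢ)) ⟩
    at (x ∷ xs) i              ≡⟨ atᵢ ⟩
    just _                     ∎)
    where
    open ≡-Reasoning
    L = length (x ∷ xs)

  factor-+1 : ∀ (W : List A) i j → factor W (i + 1) (j + 1) ≡ take (suc j ∸ i) (drop i W)
  factor-+1 W i j rewrite +-comm i 1 | +-comm j 1 = refl

AltLessAt : {A : Set a} → Rel A ℓ → ℕ → A → A → Set _
AltLessAt _<ₐ_ i u v = (Even i × u <ₐ v) ⊎ (Odd i × v <ₐ u)

module _ {_<ₐ_ : Rel A ℓ} (sto : IsStrictTotalOrder _≡_ _<ₐ_) where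
  open IsStrictTotalOrder sto using (irrefl; asym)

  altLessAt⇒≢ : ∀ i {u v} → AltLessAt _<ₐ_ i u v → u ≢ v
  altLessAt⇒≢ _ (inj₁ (_ , u<v)) u≡v = irrefl u≡v u<v
  altLessAt⇒≢ _ (inj₂ (_ , v<u)) u≡v = irrefl (sym u≡v) v<u

  altLessAt-asym : ∀ i j {u v} → i % 2 ≡ j % 2 → AltLessAt _<ₐ_ i u v → ¬ AltLessAt _<ₐ_ j v u
  altLessAt-asym _ _ _   (inj₁ (_ , u<v))    (inj₁ (_ , v<u))    = asym u<v v<u
  altLessAt-asym _ _ _   (inj₂ (_ , v<u))    (inj₂ (_ , u<v))    = asym u<v v<u
  altLessAt-asym i j i≡j (inj₁ (evenᵢ , _)) (inj₂ (oddⱼ , _))  = odd⇒¬even j oddⱼ (trans (sym i≡j) evenᵢ)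
  altLessAt-asym i j i≡j (inj₂ (oddᵢ , _))  (inj₁ (evenⱼ , _)) = odd⇒¬even i oddᵢ (trans i≡j evenⱼ)

  ≺alt-irrefl : ∀ (X : List A) → ¬ (_<ₐ_ ⊢ X ≺alt X)
  ≺alt-irrefl []       (lift ())
  ≺alt-irrefl (x ∷ xs) (i , _ , alt) = altLessAt⇒≢ i alt refl

  ≺alt-firstMismatch : ∀ (X Y : List A) j {u v} → (∀ s → s < j → at X s ≡ at Y s) →
    at X j ≡ just u → at Y j ≡ just v → u ≢ v →
    _<ₐ_ ⊢ X ≺alt Y → AltLessAt _<ₐ_ j u v
  ≺alt-firstMismatch [] _ j _ () _ _ _
  ≺alt-firstMismatch (x ∷ xs) [] j _ _ () _ _
  ≺alt-firstMismatch (x ∷ xs) (y ∷ ys) j agree atX atY u≢v (i , sameBelow , altᵢ)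
    with <-cmp i j
  ... | tri< i<j _ _ = ⊥-elim (altLessAt⇒≢ i altᵢ
    (trans (at≡just⇒omega≡ x xs i atXᵢ) (sym (at≡just⇒omega≡ y ys i atYᵢ))))
    where
    atXᵢ = proj₂ (<⇒at-just (x ∷ xs) i (<-trans i<j (at-just⇒< (x ∷ xs) j atX)))
    atYᵢ = trans (sym (agree i i<j)) atXᵢ
  ... | tri≈ _ refl _ = subst₂ (AltLessAt _<ₐ_ i) (at≡just⇒omega≡ x xs i atX) (at≡just⇒omega≡ y ys i atY) altᵢ
  ... | tri> _ _ j<i = ⊥-elim (u≢v (begin
    _               ≡⟨ at≡just⇒omega≡ x xs j atX ⟨
    omega x xs j    ≡⟨ sameBelow j j<i ⟩
    omega y ys j    ≡⟨ at≡just⇒omega≡ y ys j atY ⟩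
    _               ∎))
    where open ≡-Reasoning

  ≺alt-take-lastMismatch : ∀ (U V : List A) j {u v} → (∀ s → s < j → at U s ≡ at V s) →
    at U j ≡ just u → at V j ≡ just v →
    _<ₐ_ ⊢ take (suc j) U ≺alt take (suc j) V → u ≢ v × AltLessAt _<ₐ_ j u v
  ≺alt-take-lastMismatch U V j {u} {v} agree atU atV lt = u≢v , ≺alt-firstMismatch X Y j agreeXY atX atY u≢v lt
    where
    X = take (suc j) U
    Y = take (suc j) V
    agreeXY : ∀ s → s < j → at X s ≡ at Y s
    agreeXY s s<j = trans (at-take< U (suc j) s (m<n⇒m<1+n s<j))
                      (trans (agree s s<j) (sym (at-take< V (suc j) s (m<n⇒m<1+n s<j))))
    atX = trans (at-take< U (suc j) j ≤-refl) atU
    atY = trans (at-take< V (suc j) j ≤-refl) atV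
    u≢v : u ≢ v
    u≢v refl = ≺alt-irrefl X (subst (_<ₐ_ ⊢ X ≺alt_) (sym (at-extensionality X Y pointwise)) lt)
      where
      pointwise : ∀ s → at X s ≡ at Y s
      pointwise s with <-cmp s j
      ... | tri< s<j _ _ = agreeXY s s<j
      ... | tri≈ _ refl _ = trans atX (sym atY)
      ... | tri> _ _ j<s = trans (at-take≥ U (suc j) s j<s) (sym (at-take≥ V (suc j) s j<s))

  preGalois-firstMismatch : ∀ {T : List A} → PreGalois _<ₐ_ T → ∀ {k j u v} → 1 ≤ k → k ≤ length T →
    (∀ s → s < j → at T s ≡ at (drop k T) s) → at T j ≡ just u → at (drop k T) j ≡ just v → u ≢ v →
    AltLessAt _<ₐ_ j u v
  preGalois-firstMismatch {T} preGalois {k} {j} 1≤k k≤n agree atT atS u≢v with preGalois k 1≤k k≤n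
  ... | inj₁ prefix = ⊥-elim (u≢v (just-injective (trans (sym atT) (at-isPrefix prefix atS))))
  ... | inj₂ lt     = ≺alt-firstMismatch T (drop k T) j agree atT atS u≢v lt

module _ {A : Set a} where

  isPeriod-length : ∀ (W : List A) → 1 ≤ length W → IsPeriod W (length W)
  isPeriod-length W 1≤n = 1≤n , ≤-refl , λ i i+n<n → ⊥-elim (m+n≮n i (length W) i+n<n)

  isPeriod-++⁻ˡ : ∀ (W V : List A) {p} → IsPeriod (W ++ V) p → p ≤ length W → IsPeriod W p
  isPeriod-++⁻ˡ W V {p} (1≤p , _ , periodic) p≤n = 1≤p , p≤n , periodicW
    where
    periodicW : ∀ i → i + p < length W → at W (i + p) ≡ at W i
    periodicW i i+p<n = begin
      at W (i + p)         ≡⟨ at-++ˡ W V (i + p) i+p<n ⟨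
      at (W ++ V) (i + p)  ≡⟨ periodic i (<-≤-trans i+p<n (subst (length W ≤_) (sym (length-++ W)) (m≤m+n _ _))) ⟩
      at (W ++ V) i        ≡⟨ at-++ˡ W V i (≤-<-trans (m≤m+n i p) i+p<n) ⟩
      at W i               ∎
      where open ≡-Reasoning

  isPeriod-snoc-last : ∀ (W : List A) z {p} → IsPeriod (W ++ [ z ]) p → p ≤ length W →
    at W (length W ∸ p) ≡ just z
  isPeriod-snoc-last W z {p} (1≤p , _ , periodic) p≤n = begin
    at W (n ∸ p)                ≡⟨ at-++ˡ W [ z ] (n ∸ p) (∸-monoʳ-< 1≤p p≤n) ⟨
    at (W ++ [ z ]) (n ∸ p)     ≡⟨ periodic (n ∸ p) (subst (_< length (W ++ [ z ])) (sym (m∸n+n≡m p≤n)) n<n+1) ⟨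
    at (W ++ [ z ]) (n ∸ p + p) ≡⟨ cong (at (W ++ [ z ])) (m∸n+n≡m p≤n) ⟩
    at (W ++ [ z ]) n           ≡⟨ at-++-length W z ⟩
    just z                      ∎
    where
    open ≡-Reasoning
    n = length W
    n<n+1 : n < length (W ++ [ z ])
    n<n+1 = subst (n <_) (sym (length-snoc W z)) ≤-refl

  isPeriod-∸-shift : ∀ {W : List A} {p q} → IsPeriod W p → IsPeriod W q → q ≤ p →
    ∀ s → s + p < length W → at W (p ∸ q + s) ≡ at W s
  isPeriod-∸-shift {W} {p} {q} (_ , _ , p-periodic) (_ , _ , q-periodic) q≤p s s+p<n = begin
    at W (p ∸ q + s)      ≡⟨ q-periodic (p ∸ q + s) (subst (_< length W) (sym shift) s+p<n) ⟨
    at W (p ∸ q + s + q)  ≡⟨ cong (at W) shift ⟩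
    at W (s + p)          ≡⟨ p-periodic s s+p<n ⟩
    at W s                ∎
    where
    open ≡-Reasoning
    shift : p ∸ q + s + q ≡ s + p
    shift = begin
      p ∸ q + s + q    ≡⟨ +-assoc (p ∸ q) s q ⟩
      p ∸ q + (s + q)  ≡⟨ cong (p ∸ q +_) (+-comm s q) ⟩
      p ∸ q + (q + s)  ≡⟨ +-assoc (p ∸ q) q s ⟨
      p ∸ q + q + s    ≡⟨ cong (_+ s) (m∸n+n≡m q≤p) ⟩
      p + s            ≡⟨ +-comm p s ⟩
      s + p            ∎

  perO-of-longOddPeriods : ∀ (W : List A) {q} → PerO W q → 1 ≤ length W →
    (∀ p → IsPeriod W p → Odd p → length W ≤ p) →
    (Odd (length W) → q ≡ length W) × (Even (length W) → q ≡ suc (length W))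
  perO-of-longOddPeriods W {q} (inj₁ (period@(_ , q≤n , _) , odd , _)) _ long =
    (λ _ → q≡n) , λ even → ⊥-elim (odd⇒¬even q odd (subst Even (sym q≡n) even))
    where
    q≡n : q ≡ length W
    q≡n = ≤-antisym q≤n (long q period odd)
  perO-of-longOddPeriods W (inj₂ (q≡n+1 , noOdd)) 1≤n _ =
    (λ odd → ⊥-elim (noOdd (length W) (isPeriod-length W 1≤n) odd)) , λ _ → q≡n+1

module _ {_<ₐ_ : Rel A ℓ} (sto : IsStrictTotalOrder _≡_ _<ₐ_) where

  preGalois-periodsMismatch : ∀ {T : List A} → PreGalois _<ₐ_ T → ∀ {p q u v} →
    IsPeriod T p → IsPeriod T q → q < p →
    at T (length T ∸ p) ≡ just u → at T (length T ∸ q) ≡ just v → u ≢ v →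
    AltLessAt _<ₐ_ (length T ∸ p) u v
  preGalois-periodsMismatch {T} preGalois {p} {q} {v = v} p-period@(_ , p≤n , _) q-period q<p atⱼ atᵣ u≢v =
    preGalois-firstMismatch sto preGalois (m<n⇒0<n∸m q<p) (≤-trans (m∸n≤m p q) p≤n) agree atⱼ atShifted u≢v
    where
    agree : ∀ s → s < length T ∸ p → at T s ≡ at (drop (p ∸ q) T) s
    agree s s<j = sym (trans (at-drop T (p ∸ q) s)
      (isPeriod-∸-shift {W = T} p-period q-period (<⇒≤ q<p) s (m≤o∸n⇒m+n≤o (suc s) p≤n s<j)))
    atShifted : at (drop (p ∸ q) T) (length T ∸ p) ≡ just v
    atShifted = trans (at-drop T (p ∸ q) (length T ∸ p))
                  (trans (cong (at T) ([p∸q]+[n∸p]≡n∸q (<⇒≤ q<p) p≤n)) atᵣ)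

  border-mismatch : ∀ (T : List A) z {pₒ c} → IsPeriod T pₒ → at T (length T ∸ pₒ) ≡ just c →
    _<ₐ_ ⊢ factor (T ++ [ z ]) 1 (suc (length T) ∸ pₒ) ≺alt factor (T ++ [ z ]) (pₒ + 1) (length T + 1) →
    c ≢ z × AltLessAt _<ₐ_ (length T ∸ pₒ) c z
  border-mismatch T z {pₒ} {c} (1≤pₒ , pₒ≤n , periodic) atT lt =
    ≺alt-take-lastMismatch sto T′ (drop pₒ T′) r agree atT′ atShifted (asTakes lt)
    where
    open ≡-Reasoning
    n = length T
    T′ = T ++ [ z ]
    r = n ∸ pₒ
    r<n : r < n
    r<n = ∸-monoʳ-< 1≤pₒ pₒ≤n
    -- factor T′ 1 m computes to take m T′.
    asTakes : _<ₐ_ ⊢ factor T′ 1 (suc n ∸ pₒ) ≺alt factor T′ (pₒ + 1) (n + 1) →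
      _<ₐ_ ⊢ take (suc r) T′ ≺alt take (suc r) (drop pₒ T′)
    asTakes = subst (λ m → _<ₐ_ ⊢ take m T′ ≺alt take m (drop pₒ T′)) (+-∸-assoc 1 pₒ≤n)
            ∘ subst (_<ₐ_ ⊢ take (suc n ∸ pₒ) T′ ≺alt_) (factor-+1 T′ pₒ n)
    agree : ∀ s → s < r → at T′ s ≡ at (drop pₒ T′) s
    agree s s<r = begin
      at T′ s             ≡⟨ at-++ˡ T [ z ] s (<-trans s<r r<n) ⟩
      at T s              ≡⟨ periodic s s+pₒ<n ⟨
      at T (s + pₒ)       ≡⟨ at-++ˡ T [ z ] (s + pₒ) s+pₒ<n ⟨
      at T′ (s + pₒ)      ≡⟨ cong (at T′) (+-comm s pₒ) ⟩
      at T′ (pₒ + s)      ≡⟨ at-drop T′ pₒ s ⟨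
      at (drop pₒ T′) s   ∎
      where
      s+pₒ<n : s + pₒ < n
      s+pₒ<n = m≤o∸n⇒m+n≤o (suc s) pₒ≤n s<r
    atT′ : at T′ r ≡ just c
    atT′ = trans (at-++ˡ T [ z ] r r<n) atT
    atShifted : at (drop pₒ T′) r ≡ just z
    atShifted = begin
      at (drop pₒ T′) r   ≡⟨ at-drop T′ pₒ r ⟩
      at T′ (pₒ + r)      ≡⟨ cong (at T′) (m+[n∸m]≡n pₒ≤n) ⟩
      at T′ n             ≡⟨ at-++-length T z ⟩
      just z              ∎

  preGalois-snoc-¬oddPeriod≤length : ∀ {T : List A} → PreGalois _<ₐ_ T → ∀ {pₒ} → PerO T pₒ → ∀ z →
    _<ₐ_ ⊢ factor (T ++ [ z ]) 1 (suc (length T) ∸ pₒ) ≺alt factor (T ++ [ z ]) (pₒ + 1) (length T + 1) →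
    ∀ {p} → IsPeriod (T ++ [ z ]) p → Odd p → ¬ p ≤ length T
  preGalois-snoc-¬oddPeriod≤length {T} _ (inj₂ (_ , noOdd)) z _ period′ odd p≤n =
    noOdd _ (isPeriod-++⁻ˡ T [ z ] period′ p≤n) odd
  preGalois-snoc-¬oddPeriod≤length {T} preGalois {pₒ} (inj₁ (periodₒ@(1≤pₒ , pₒ≤n , _) , oddₒ , minₒ)) z lt
    {p} period′ odd p≤n with <⇒at-just T (length T ∸ pₒ) (∸-monoʳ-< 1≤pₒ pₒ≤n)
  ... | c , atᵣ = contradiction (m≤n⇒m<n∨m≡n pₒ≤p)
    where
    n = length T
    period = isPeriod-++⁻ˡ T [ z ] period′ p≤n
    pₒ≤p = minₒ p period odd
    atⱼ : at T (n ∸ p) ≡ just z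
    atⱼ = isPeriod-snoc-last T z period′ p≤n
    borderMismatch = border-mismatch T z periodₒ atᵣ lt
    sameParity : (n ∸ pₒ) % 2 ≡ (n ∸ p) % 2
    sameParity = trans (cong (_% 2) (sym ([p∸q]+[n∸p]≡n∸q pₒ≤p p≤n)))
                   (even⇒[m+n]%2≡n%2 (p ∸ pₒ) (n ∸ p) ([m%2≡n%2]⇒even[m∸n] p pₒ (trans odd (sym oddₒ))))
    contradiction : pₒ < p ⊎ pₒ ≡ p → ⊥
    contradiction (inj₂ refl) = proj₁ borderMismatch (just-injective (trans (sym atᵣ) atⱼ))
    contradiction (inj₁ pₒ<p) = altLessAt-asym sto (n ∸ pₒ) (n ∸ p) sameParity (proj₂ borderMismatch)
      (preGalois-periodsMismatch preGalois period periodₒ pₒ<p atⱼ atᵣ (proj₁ borderMismatch ∘ sym))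

lemma22 : ∀ {a ℓ} {A : Set a} (_<ₐ_ : Rel A ℓ) → IsStrictTotalOrder _≡_ _<ₐ_ →
    (T : List A) → PreGalois _<ₐ_ T →
    (pₒ : ℕ) → PerO T pₒ →
    (z : A) →
    _<ₐ_ ⊢ factor (T ++ [ z ]) 1 (suc (length T) ∸ pₒ) ≺alt factor (T ++ [ z ]) (pₒ + 1) (length T + 1) →
    (q : ℕ) → PerO (T ++ [ z ]) q →
    (Odd (length (T ++ [ z ])) → q ≡ length (T ++ [ z ]))
      × (Even (length (T ++ [ z ])) → q ≡ suc (length (T ++ [ z ])))
lemma22 _<ₐ_ sto T preGalois pₒ perOₒ z lt q perO′ =
  perO-of-longOddPeriods (T ++ [ z ]) perO′ (subst (1 ≤_) (sym |T′|≡n+1) (s≤s z≤n)) oddPeriodsLong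
  where
  |T′|≡n+1 = length-snoc T z
  oddPeriodsLong : ∀ p → IsPeriod (T ++ [ z ]) p → Odd p → length (T ++ [ z ]) ≤ p
  oddPeriodsLong p period′ odd = subst (_≤ p) (sym |T′|≡n+1)
    (≰⇒> (preGalois-snoc-¬oddPeriod≤length sto preGalois perOₒ z lt period′ odd))
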